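{- Let $F=(F_1,\ldots,F_n)\in\mathbb{Z}[X_1,\ldots,X_n]^n$ be a polynomial map of the form $F_i=X_i+H_i$, where each $H_i$ has lower degree $\ge 2$, and let $D=\max_i\deg H_i$. Let $P_0(X)=X$, $P_{k+1}=P_k\circ F-P_k$. Then for every $k=1,2,\ldots$ we have \[ l(P_{k+1})\le l(P_k)\cdot\big[l(F)^{D^k}+1\big].\]
   Context: The lower degree of a polynomial is the minimal total degree of a monomial appearing in it with nonzero coefficient. For a polynomial $T$, its length $l(T)$ is the number of monomials appearing in $T$ (with nonzero coefficient); for a polynomial map $T=(T_1,\ldots,T_n)$, $l(T)=\max\{l(T_1),\ldots,l(T_n)\}$. -}

module Defs where

open import Data.Nat as ℕ using (ℕ; zero; suc; _⊔_; _≤_)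
open import Data.Integer as ℤ using (ℤ; 0ℤ; 1ℤ)
open import Data.Fin as Fin using (Fin)
open import Data.Vec as Vec using (Vec; []; _∷_)
open import Data.Vec.Properties using (≡-dec)
open import Data.List as List using (List; []; _∷_; _++_; map; concatMap; foldr; filter; length; deduplicate; allFin)
open import Data.Product using (_×_; _,_; proj₁; proj₂)
open import Relation.Nullary using (¬?)
open import Relation.Binary.Definitions using (DecidableEquality)
open import Relation.Binary.PropositionalEquality using (_≢_)

Monomial : ℕ → Set
Monomial n = Vec ℕ n

_≟ₘ_ : ∀ {n} → DecidableEquality (Monomial n)
_≟ₘ_ = ≡-dec ℕ._≟_

totalDeg : ∀ {n} → Monomial n → ℕ
totalDeg = Vec.sum

-- A polynomial in ℤ[X_1..X_n] as a formal (not necessarily normalised) finite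
-- sum of terms c·X^a.  Its meaning is the coefficient function `coeff`.
Poly : ℕ → Set
Poly n = List (ℤ × Monomial n)

coeff : ∀ {n} → Poly n → Monomial n → ℤ
coeff p m = foldr ℤ._+_ 0ℤ (map proj₁ (filter (λ t → proj₂ t ≟ₘ m) p))

support : ∀ {n} → Poly n → List (Monomial n)
support p = filter (λ m → ¬? (coeff p m ℤ.≟ 0ℤ)) (deduplicate _≟ₘ_ (map proj₂ p))

len : ∀ {n} → Poly n → ℕ
len p = length (support p)

deg : ∀ {n} → Poly n → ℕ
deg p = foldr _⊔_ 0 (map totalDeg (support p))

LowerDegAtLeast : ∀ {n} → ℕ → Poly n → Set
LowerDegAtLeast d p = ∀ m → coeff p m ≢ 0ℤ → d ≤ totalDeg m

constP : ∀ {n} → ℤ → Poly n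
constP c = (c , Vec.replicate _ 0) ∷ []

oneP : ∀ {n} → Poly n
oneP = constP 1ℤ

var : ∀ {n} → Fin n → Poly n
var i = (1ℤ , (Vec.replicate _ 0 Vec.[ i ]≔ 1)) ∷ []

_+ₚ_ : ∀ {n} → Poly n → Poly n → Poly n
p +ₚ q = p ++ q

negP : ∀ {n} → Poly n → Poly n
negP = map (λ t → ℤ.- proj₁ t , proj₂ t)

_-ₚ_ : ∀ {n} → Poly n → Poly n → Poly n
p -ₚ q = p ++ negP q

_*ₚ_ : ∀ {n} → Poly n → Poly n → Poly n
p *ₚ q = concatMap (λ s → map (λ t → proj₁ s ℤ.* proj₁ t , Vec.zipWith ℕ._+_ (proj₂ s) (proj₂ t)) q) p

powP : ∀ {n} → Poly n → ℕ → Poly n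
powP p zero = oneP
powP p (suc k) = p *ₚ powP p k

PolyMap : ℕ → Set
PolyMap n = Fin n → Poly n

monAt : ∀ {m n} → Monomial m → (Fin m → Poly n) → Poly n
monAt [] G = oneP
monAt (e ∷ a) G = powP (G Fin.zero) e *ₚ monAt a (λ i → G (Fin.suc i))

compose : ∀ {m n} → Poly m → (Fin m → Poly n) → Poly n
compose P G = concatMap (λ t → constP (proj₁ t) *ₚ monAt (proj₂ t) G) P

_∘ₘ_ : ∀ {n} → PolyMap n → PolyMap n → PolyMap n
(T ∘ₘ G) i = compose (T i) G

idMap : ∀ {n} → PolyMap n
idMap = var

lenMap : ∀ {n} → PolyMap n → ℕ
lenMap {n} T = foldr _⊔_ 0 (map (λ i → len (T i)) (allFin n))

addId : ∀ {n} → PolyMap n → PolyMap n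
addId H i = var i +ₚ H i

maxDeg : ∀ {n} → PolyMap n → ℕ
maxDeg {n} H = foldr _⊔_ 0 (map (λ i → deg (H i)) (allFin n))

Pseq : ∀ {n} → PolyMap n → ℕ → PolyMap n
Pseq F zero = idMap
Pseq F (suc k) i = ((Pseq F k) ∘ₘ F) i -ₚ Pseq F k i

module Submission where

-- Every monomial of Pₖᵢ ∘ F arises
-- from a monomial X^a of Pₖᵢ by choosing one monomial of Fⱼ for each of the |a|
-- factors of X^a, so X^a contributes at most l(F)^|a| monomials, and −Pₖᵢ adds
-- at most l(Pₖᵢ) more.  Hence l(Pₖ₊₁ᵢ) ≤ l(Pₖᵢ)·(B + 1) whenever l(F)^|a| ≤ B
-- for all monomials X^a of Pₖᵢ.  As deg Fⱼ ≤ D, induction gives deg Pₖ ≤ D^k,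
-- so B = l(F)^(D^k) works.  (If D = 0 then H = 0, l(F) ≤ 1 and B = 1 works.)

open import Defs
open import Data.Nat as ℕ using (ℕ; zero; suc; _≤_; _*_; _+_; _^_; _⊔_; z≤n; s≤s)
import Data.Nat.Properties as NP
open import Data.Nat.Tactic.RingSolver as NatSolver using ()
open import Data.Integer as ℤ using (ℤ; 0ℤ; 1ℤ)
import Data.Integer.Properties as ℤP
open import Data.Integer.Tactic.RingSolver using (solve-∀)
open import Data.Fin as Fin using (Fin)
open import Data.Vec as Vec using ([]; _∷_)
open import Data.List
  using (List; []; _∷_; _++_; map; concatMap; foldr; filter; length; deduplicate; allFin; cartesianProductWith)
import Data.List.Properties as LP
open import Data.List.Membership.Propositional using (_∈_; find; lose)
open import Data.List.Membership.Propositional.Properties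
open import Data.List.Relation.Unary.Any as Any using (here; there)
open import Data.List.Relation.Unary.All as All using (All; []; _∷_)
open import Data.List.Relation.Unary.Unique.Propositional using (Unique)
open import Data.List.Relation.Unary.AllPairs using (_∷_)
import Data.List.Relation.Unary.Unique.Propositional.Properties as UniqueP
import Data.List.Relation.Unary.Unique.DecPropositional.Properties as UniqueDecP
open import Data.Product using (_×_; _,_; proj₁; proj₂; ∃-syntax)
open import Data.Sum using (_⊎_; inj₁; inj₂)
open import Data.Empty using (⊥-elim)
open import Relation.Nullary using (yes; no; ¬?)
open import Relation.Binary.Definitions using (DecidableEquality)
open import Relation.Binary.PropositionalEquality

-- ⟨p , w⟩ = Σ c·w(a) over the terms c·X^a of the formal sum p.  The
-- coefficient of m is the pairing with the Kronecker delta at m.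
pairing : ∀ {n} → Poly n → (Monomial n → ℤ) → ℤ
pairing []            w = 0ℤ
pairing ((c , a) ∷ p) w = c ℤ.* w a ℤ.+ pairing p w

δ : ∀ {n} → Monomial n → Monomial n → ℤ
δ m a with a ≟ₘ m
... | yes _ = 1ℤ
... | no  _ = 0ℤ

δ-nonzero : ∀ {n} (m a : Monomial n) → δ m a ≢ 0ℤ → a ≡ m
δ-nonzero m a ne with a ≟ₘ m
... | yes a≡m = a≡m
... | no  _   = ⊥-elim (ne refl)

coeff-pairing : ∀ {n} (p : Poly n) m → coeff p m ≡ pairing p (δ m)
coeff-pairing []            m = refl
coeff-pairing ((c , a) ∷ p) m with a ≟ₘ m
... | yes _ = cong₂ ℤ._+_ (sym (ℤP.*-identityʳ c)) (coeff-pairing p m)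
... | no  _ = begin
  coeff p m                        ≡⟨ coeff-pairing p m ⟩
  pairing p (δ m)                  ≡⟨ sym (ℤP.+-identityˡ _) ⟩
  0ℤ ℤ.+ pairing p (δ m)           ≡⟨ cong (ℤ._+ pairing p (δ m)) (sym (ℤP.*-zeroʳ c)) ⟩
  c ℤ.* 0ℤ ℤ.+ pairing p (δ m)     ∎
  where open ≡-Reasoning

pairing-ext : ∀ {n} (p : Poly n) {w v} → (∀ a → w a ≡ v a) → pairing p w ≡ pairing p v
pairing-ext []            w≗v = refl
pairing-ext ((c , a) ∷ p) w≗v = cong₂ (λ x y → c ℤ.* x ℤ.+ y) (w≗v a) (pairing-ext p w≗v)

pairing-++ : ∀ {n} (p q : Poly n) w → pairing (p ++ q) w ≡ pairing p w ℤ.+ pairing q w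
pairing-++ []            q w = sym (ℤP.+-identityˡ _)
pairing-++ ((c , a) ∷ p) q w =
  trans (cong (λ z → c ℤ.* w a ℤ.+ z) (pairing-++ p q w))
        (sym (ℤP.+-assoc (c ℤ.* w a) (pairing p w) (pairing q w)))

pairing-neg : ∀ {n} (p : Poly n) w → pairing (negP p) w ≡ ℤ.- pairing p w
pairing-neg []            w = refl
pairing-neg ((c , a) ∷ p) w =
  trans (cong₂ ℤ._+_ (sym (ℤP.neg-distribˡ-* c (w a))) (pairing-neg p w))
        (sym (ℤP.neg-distrib-+ (c ℤ.* w a) (pairing p w)))

_·ₘ_ : ∀ {n} → Monomial n → Monomial n → Monomial n
a ·ₘ b = Vec.zipWith ℕ._+_ a b

1ₘ : ∀ {n} → Monomial n
1ₘ = Vec.replicate _ 0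

·ₘ-identityˡ : ∀ {n} (b : Monomial n) → 1ₘ ·ₘ b ≡ b
·ₘ-identityˡ []      = refl
·ₘ-identityˡ (x ∷ b) = cong (x ∷_) (·ₘ-identityˡ b)

pairing-mul : ∀ {n} (p q : Poly n) w →
  pairing (p *ₚ q) w ≡ pairing p (λ a → pairing q (λ b → w (a ·ₘ b)))
pairing-mul []            q w = refl
pairing-mul ((c , a) ∷ p) q w =
  trans (pairing-++ (scaled q) (p *ₚ q) w) (cong₂ ℤ._+_ (pairing-scaled q) (pairing-mul p q w))
  where
  scaled : Poly _ → Poly _
  scaled = map (λ t → c ℤ.* proj₁ t , a ·ₘ proj₂ t)

  regroup-mul : ∀ c d x y → c ℤ.* d ℤ.* x ℤ.+ c ℤ.* y ≡ c ℤ.* (d ℤ.* x ℤ.+ y)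
  regroup-mul = solve-∀

  pairing-scaled : ∀ q → pairing (scaled q) w ≡ c ℤ.* pairing q (λ b → w (a ·ₘ b))
  pairing-scaled []            = sym (ℤP.*-zeroʳ c)
  pairing-scaled ((d , b) ∷ q) =
    trans (cong (λ z → c ℤ.* d ℤ.* w (a ·ₘ b) ℤ.+ z) (pairing-scaled q))
          (regroup-mul c d (w (a ·ₘ b)) (pairing q (λ b → w (a ·ₘ b))))

pairing-compose : ∀ {m n} (P : Poly m) (G : Fin m → Poly n) w →
  pairing (compose P G) w ≡ pairing P (λ a → pairing (monAt a G) w)
pairing-compose []            G w = refl
pairing-compose ((c , a) ∷ P) G w =
  trans (pairing-++ (constP c *ₚ monAt a G) (compose P G) w)
        (cong₂ ℤ._+_ constant-multiple (pairing-compose P G w))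
  where
  constant-multiple : pairing (constP c *ₚ monAt a G) w ≡ c ℤ.* pairing (monAt a G) w
  constant-multiple =
    trans (pairing-mul (constP c) (monAt a G) w)
      (trans (ℤP.+-identityʳ _)
        (cong (c ℤ.*_) (pairing-ext (monAt a G) (λ b → cong w (·ₘ-identityˡ b)))))

coeff-++ : ∀ {n} (p q : Poly n) m → coeff (p ++ q) m ≡ coeff p m ℤ.+ coeff q m
coeff-++ p q m = begin
  coeff (p ++ q) m                     ≡⟨ coeff-pairing (p ++ q) m ⟩
  pairing (p ++ q) (δ m)               ≡⟨ pairing-++ p q (δ m) ⟩
  pairing p (δ m) ℤ.+ pairing q (δ m)  ≡⟨ sym (cong₂ ℤ._+_ (coeff-pairing p m) (coeff-pairing q m)) ⟩
  coeff p m ℤ.+ coeff q m              ∎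
  where open ≡-Reasoning

coeff-neg : ∀ {n} (p : Poly n) m → coeff (negP p) m ≡ ℤ.- coeff p m
coeff-neg p m =
  trans (coeff-pairing (negP p) m)
        (trans (pairing-neg p (δ m)) (cong ℤ.-_ (sym (coeff-pairing p m))))

sumOver : ∀ {n} → List (Monomial n) → (Monomial n → ℤ) → ℤ
sumOver []      g = 0ℤ
sumOver (a ∷ L) g = g a ℤ.+ sumOver L g

sumOver-ext : ∀ {n} (L : List (Monomial n)) {g h} → (∀ a → g a ≡ h a) → sumOver L g ≡ sumOver L h
sumOver-ext []      g≗h = refl
sumOver-ext (a ∷ L) g≗h = cong₂ ℤ._+_ (g≗h a) (sumOver-ext L g≗h)

sumOver-+ : ∀ {n} (L : List (Monomial n)) g h →
  sumOver L (λ a → g a ℤ.+ h a) ≡ sumOver L g ℤ.+ sumOver L h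
sumOver-+ []      g h = refl
sumOver-+ (a ∷ L) g h =
  trans (cong (λ z → g a ℤ.+ h a ℤ.+ z) (sumOver-+ L g h)) (interchange (g a) (h a) (sumOver L g) (sumOver L h))
  where
  interchange : ∀ x y z u → x ℤ.+ y ℤ.+ (z ℤ.+ u) ≡ x ℤ.+ z ℤ.+ (y ℤ.+ u)
  interchange = solve-∀

sumOver-zero : ∀ {n} (L : List (Monomial n)) g → (∀ a → g a ≡ 0ℤ) → sumOver L g ≡ 0ℤ
sumOver-zero []      g g≗0 = refl
sumOver-zero (a ∷ L) g g≗0 = cong₂ ℤ._+_ (g≗0 a) (sumOver-zero L g g≗0)

sumOver-δ-absent : ∀ {n} (L : List (Monomial n)) b (g : Monomial n → ℤ) →
  All (b ≢_) L → sumOver L (λ a → δ a b ℤ.* g a) ≡ 0ℤ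
sumOver-δ-absent []      b g []            = refl
sumOver-δ-absent (a ∷ L) b g (b≢a ∷ b∉L) with b ≟ₘ a
... | yes b≡a = ⊥-elim (b≢a b≡a)
... | no  _   = cong (λ z → 0ℤ ℤ.+ z) (sumOver-δ-absent L b g b∉L)

sumOver-δ : ∀ {n} (L : List (Monomial n)) b (g : Monomial n → ℤ) →
  Unique L → b ∈ L → sumOver L (λ a → δ a b ℤ.* g a) ≡ g b
sumOver-δ (a ∷ L) b g (a∉L ∷ uL) b∈ with b ≟ₘ a
sumOver-δ (a ∷ L) b g (a∉L ∷ uL) b∈         | yes refl =
  trans (cong₂ ℤ._+_ (ℤP.*-identityˡ (g b)) (sumOver-δ-absent L b g a∉L)) (ℤP.+-identityʳ _)
sumOver-δ (a ∷ L) b g (a∉L ∷ uL) (here b≡a)  | no b≢a  = ⊥-elim (b≢a b≡a)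
sumOver-δ (a ∷ L) b g (a∉L ∷ uL) (there b∈) | no _    =
  trans (ℤP.+-identityˡ _) (sumOver-δ L b g uL b∈)

regroup : ∀ {n} (p : Poly n) w (L : List (Monomial n)) → Unique L → All (_∈ L) (map proj₂ p) →
  pairing p w ≡ sumOver L (λ a → pairing p (δ a) ℤ.* w a)
regroup []            w L uL []           = sym (sumOver-zero L _ (λ a → ℤP.*-zeroˡ (w a)))
regroup ((c , b) ∷ p) w L uL (b∈L ∷ p⊆L) = sym (begin
  sumOver L (λ a → (c ℤ.* δ a b ℤ.+ pairing p (δ a)) ℤ.* w a)
    ≡⟨ sumOver-ext L (λ a → distribute c (δ a b) (pairing p (δ a)) (w a)) ⟩
  sumOver L (λ a → δ a b ℤ.* (c ℤ.* w a) ℤ.+ pairing p (δ a) ℤ.* w a)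
    ≡⟨ sumOver-+ L _ _ ⟩
  sumOver L (λ a → δ a b ℤ.* (c ℤ.* w a)) ℤ.+ sumOver L (λ a → pairing p (δ a) ℤ.* w a)
    ≡⟨ cong₂ ℤ._+_ (sumOver-δ L b (λ a → c ℤ.* w a) uL b∈L) (sym (regroup p w L uL p⊆L)) ⟩
  c ℤ.* w b ℤ.+ pairing p w ∎)
  where
  open ≡-Reasoning
  distribute : ∀ c d x y → (c ℤ.* d ℤ.+ x) ℤ.* y ≡ d ℤ.* (c ℤ.* y) ℤ.+ x ℤ.* y
  distribute = solve-∀

sumOver-nonzero : ∀ {n} (L : List (Monomial n)) g → sumOver L g ≢ 0ℤ → ∃[ a ] (a ∈ L × g a ≢ 0ℤ)
sumOver-nonzero []      g ne = ⊥-elim (ne refl)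
sumOver-nonzero (a ∷ L) g ne with g a ℤ.≟ 0ℤ
... | no  ga≢0 = a , here refl , ga≢0
... | yes ga≡0 with sumOver-nonzero L g (λ rest≡0 → ne (cong₂ ℤ._+_ ga≡0 rest≡0))
...   | b , b∈L , gb≢0 = b , there b∈L , gb≢0

nonzero-pairing : ∀ {n} (p : Poly n) w → pairing p w ≢ 0ℤ → ∃[ a ] (coeff p a ≢ 0ℤ × w a ≢ 0ℤ)
nonzero-pairing {n} p w ne
  with sumOver-nonzero written _ (λ sum≡0 → ne (trans (regroup p w written unique covered) sum≡0))
  where
  written : List (Monomial n)
  written = deduplicate _≟ₘ_ (map proj₂ p)
  unique : Unique written
  unique = UniqueDecP.deduplicate-! _≟ₘ_ (map proj₂ p)
  covered : All (_∈ written) (map proj₂ p)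
  covered = All.tabulate (∈-deduplicate⁺ _≟ₘ_)
... | a , _ , term≢0 =
  a , (λ coeff≡0 → term≢0 (trans (cong (ℤ._* w a) (trans (sym (coeff-pairing p a)) coeff≡0)) (ℤP.*-zeroˡ (w a))))
    , (λ w≡0 → term≢0 (trans (cong (pairing p (δ a) ℤ.*_) w≡0) (ℤP.*-zeroʳ (pairing p (δ a)))))

SupportedIn : ∀ {n} → Poly n → List (Monomial n) → Set
SupportedIn p S = ∀ m → coeff p m ≢ 0ℤ → m ∈ S

supported-written : ∀ {n} (p : Poly n) → SupportedIn p (map proj₂ p)
supported-written []            m ne = ⊥-elim (ne refl)
supported-written ((c , a) ∷ p) m ne with a ≟ₘ m
... | yes a≡m = here (sym a≡m)
... | no  _   = there (supported-written p m ne)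

supported-support : ∀ {n} (p : Poly n) → SupportedIn p (support p)
supported-support p m ne =
  ∈-filter⁺ (λ m → ¬? (coeff p m ℤ.≟ 0ℤ)) (∈-deduplicate⁺ _≟ₘ_ (supported-written p m ne)) ne

support-nonzero : ∀ {n} (p : Poly n) {m} → m ∈ support p → coeff p m ≢ 0ℤ
support-nonzero p {m} m∈ =
  proj₂ (∈-filter⁻ (λ m → ¬? (coeff p m ℤ.≟ 0ℤ)) {m} {deduplicate _≟ₘ_ (map proj₂ p)} m∈)

plus-nonzero : ∀ x y → x ℤ.+ y ≢ 0ℤ → x ≢ 0ℤ ⊎ y ≢ 0ℤ
plus-nonzero x y ne with x ℤ.≟ 0ℤ
... | no  x≢0 = inj₁ x≢0
... | yes refl = inj₂ (λ y≡0 → ne (trans (ℤP.+-identityˡ y) y≡0))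

supported-++ : ∀ {n} (p q : Poly n) S T → SupportedIn p S → SupportedIn q T → SupportedIn (p ++ q) (S ++ T)
supported-++ p q S T p⊑S q⊑T m ne with plus-nonzero _ _ (λ sum≡0 → ne (trans (coeff-++ p q m) sum≡0))
... | inj₁ cp≢0 = ∈-++⁺ˡ (p⊑S m cp≢0)
... | inj₂ cq≢0 = ∈-++⁺ʳ S (q⊑T m cq≢0)

supported-neg : ∀ {n} (p : Poly n) S → SupportedIn p S → SupportedIn (negP p) S
supported-neg p S p⊑S m ne = p⊑S m (λ cp≡0 → ne (trans (coeff-neg p m) (cong ℤ.-_ cp≡0)))

_⊙_ : ∀ {n} → List (Monomial n) → List (Monomial n) → List (Monomial n)
S ⊙ T = cartesianProductWith _·ₘ_ S T

supported-mul : ∀ {n} (p q : Poly n) S T → SupportedIn p S → SupportedIn q T → SupportedIn (p *ₚ q) (S ⊙ T)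
supported-mul p q S T p⊑S q⊑T m ne
  with nonzero-pairing p _ (λ ⟨p⟩≡0 → ne (trans (coeff-pairing (p *ₚ q) m) (trans (pairing-mul p q (δ m)) ⟨p⟩≡0)))
... | a , cpa≢0 , ⟨q⟩≢0 with nonzero-pairing q _ ⟨q⟩≢0
...   | b , cqb≢0 , δ≢0 =
  subst (_∈ S ⊙ T) (δ-nonzero m (a ·ₘ b) δ≢0) (∈-cartesianProductWith⁺ _·ₘ_ (p⊑S a cpa≢0) (q⊑T b cqb≢0))

_^ₛ_ : ∀ {n} → List (Monomial n) → ℕ → List (Monomial n)
S ^ₛ zero  = 1ₘ ∷ []
S ^ₛ suc e = S ⊙ (S ^ₛ e)

supported-pow : ∀ {n} (p : Poly n) S → SupportedIn p S → ∀ e → SupportedIn (powP p e) (S ^ₛ e)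
supported-pow p S p⊑S zero    = supported-written oneP
supported-pow p S p⊑S (suc e) = supported-mul p (powP p e) S (S ^ₛ e) p⊑S (supported-pow p S p⊑S e)

monSupport : ∀ {m n} → Monomial m → (Fin m → List (Monomial n)) → List (Monomial n)
monSupport []      S = 1ₘ ∷ []
monSupport (e ∷ a) S = (S Fin.zero ^ₛ e) ⊙ monSupport a (λ i → S (Fin.suc i))

supported-monAt : ∀ {m n} (a : Monomial m) (G : Fin m → Poly n) S →
  (∀ j → SupportedIn (G j) (S j)) → SupportedIn (monAt a G) (monSupport a S)
supported-monAt []      G S G⊑S = supported-written oneP
supported-monAt (e ∷ a) G S G⊑S =
  supported-mul (powP (G Fin.zero) e) (monAt a (λ i → G (Fin.suc i))) _ _
    (supported-pow (G Fin.zero) (S Fin.zero) (G⊑S Fin.zero) e)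
    (supported-monAt a (λ i → G (Fin.suc i)) (λ i → S (Fin.suc i)) (λ i → G⊑S (Fin.suc i)))

compSupport : ∀ {m n} → Poly m → (Fin m → List (Monomial n)) → List (Monomial n)
compSupport P S = concatMap (λ a → monSupport a S) (support P)

-- P ∘ G is supported in compSupport P S: a monomial of P ∘ G comes from
-- some monomial a of P, since the pairing of P against the weight
-- a ↦ coeff (X^a ∘ G, m) is nonzero.
supported-compose : ∀ {m n} (P : Poly m) (G : Fin m → Poly n) S →
  (∀ j → SupportedIn (G j) (S j)) → SupportedIn (compose P G) (compSupport P S)
supported-compose P G S G⊑S m ne
  with nonzero-pairing P _ (λ ⟨P⟩≡0 → ne (trans (coeff-pairing (compose P G) m) (trans (pairing-compose P G (δ m)) ⟨P⟩≡0)))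
... | a , cPa≢0 , ⟨X^a∘G⟩≢0 = ∈-concatMap⁺ (λ a → monSupport a S) (lose a∈P m∈X^a∘G)
  where
  a∈P : a ∈ support P
  a∈P = supported-support P a cPa≢0
  m∈X^a∘G : m ∈ monSupport a S
  m∈X^a∘G = supported-monAt a G S G⊑S m (λ c≡0 → ⟨X^a∘G⟩≢0 (trans (sym (coeff-pairing (monAt a G) m)) c≡0))

unique-length : ∀ {A : Set} (_≟_ : DecidableEquality A) {xs ys : List A} →
  Unique xs → (∀ {x} → x ∈ xs → x ∈ ys) → length xs ≤ length ys
unique-length _≟_ {[]}     _             _     = z≤n
unique-length _≟_ {x ∷ xs} {ys} (x∉xs ∷ uxs) xs⊆ys =
  NP.≤-trans (s≤s (unique-length _≟_ uxs xs⊆ys-without-x))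
             (LP.filter-notAll (λ y → ¬? (x ≟ y)) ys (Any.map (λ x≡y x≢y → x≢y x≡y) (xs⊆ys (here refl))))
  where
  xs⊆ys-without-x : ∀ {y} → y ∈ xs → y ∈ filter (λ y → ¬? (x ≟ y)) ys
  xs⊆ys-without-x y∈xs = ∈-filter⁺ (λ y → ¬? (x ≟ y)) (xs⊆ys (there y∈xs)) (All.lookup x∉xs y∈xs)

len-≤ : ∀ {n} (p : Poly n) S → SupportedIn p S → len p ≤ length S
len-≤ p S p⊑S = unique-length _≟ₘ_ support-unique (λ {m} m∈ → p⊑S m (support-nonzero p m∈))
  where
  support-unique : Unique (support p)
  support-unique = UniqueP.filter⁺ (λ m → ¬? (coeff p m ℤ.≟ 0ℤ)) (UniqueDecP.deduplicate-! _≟ₘ_ (map proj₂ p))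

length-cartesianProductWith : ∀ {A B C : Set} (f : A → B → C) (xs : List A) (ys : List B) →
  length (cartesianProductWith f xs ys) ≡ length xs * length ys
length-cartesianProductWith f []       ys = refl
length-cartesianProductWith f (x ∷ xs) ys =
  trans (LP.length-++ (map (f x) ys))
        (cong₂ _+_ (LP.length-map (f x) ys) (length-cartesianProductWith f xs ys))

length-concatMap : ∀ {A B : Set} (f : A → List B) (xs : List A) B →
  (∀ {a} → a ∈ xs → length (f a) ≤ B) → length (concatMap f xs) ≤ length xs * B
length-concatMap f []       B fa≤B = z≤n
length-concatMap f (x ∷ xs) B fa≤B =
  NP.≤-trans (NP.≤-reflexive (LP.length-++ (f x)))
             (NP.+-mono-≤ (fa≤B (here refl)) (length-concatMap f xs B (λ a∈ → fa≤B (there a∈))))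

length-^ₛ : ∀ {n} (S : List (Monomial n)) e → length (S ^ₛ e) ≡ length S ^ e
length-^ₛ S zero    = refl
length-^ₛ S (suc e) = trans (length-cartesianProductWith _·ₘ_ S (S ^ₛ e)) (cong (length S *_) (length-^ₛ S e))

length-monSupport : ∀ {m n} (a : Monomial m) (S : Fin m → List (Monomial n)) L →
  (∀ j → length (S j) ≤ L) → length (monSupport a S) ≤ L ^ totalDeg a
length-monSupport []      S L S≤L = NP.≤-refl
length-monSupport (e ∷ a) S L S≤L = begin
  length ((S Fin.zero ^ₛ e) ⊙ monSupport a S′)
    ≡⟨ length-cartesianProductWith _·ₘ_ (S Fin.zero ^ₛ e) _ ⟩
  length (S Fin.zero ^ₛ e) * length (monSupport a S′)
    ≡⟨ cong (_* length (monSupport a S′)) (length-^ₛ (S Fin.zero) e) ⟩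
  length (S Fin.zero) ^ e * length (monSupport a S′)
    ≤⟨ NP.*-mono-≤ (NP.^-monoˡ-≤ e (S≤L Fin.zero)) (length-monSupport a S′ L (λ i → S≤L (Fin.suc i))) ⟩
  L ^ e * L ^ totalDeg a
    ≡⟨ sym (NP.^-distribˡ-+-* L e (totalDeg a)) ⟩
  L ^ totalDeg (e ∷ a) ∎
  where
  open NP.≤-Reasoning
  S′ : Fin _ → List (Monomial _)
  S′ i = S (Fin.suc i)

DegreesAtMost : ∀ {n} → ℕ → List (Monomial n) → Set
DegreesAtMost d S = ∀ {x} → x ∈ S → totalDeg x ≤ d

totalDeg-·ₘ : ∀ {n} (a b : Monomial n) → totalDeg (a ·ₘ b) ≡ totalDeg a + totalDeg b
totalDeg-·ₘ []      []      = refl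
totalDeg-·ₘ (x ∷ a) (y ∷ b) = trans (cong ((x + y) +_) (totalDeg-·ₘ a b)) (interchange x y (totalDeg a) (totalDeg b))
  where
  interchange : ∀ x y u v → x + y + (u + v) ≡ x + u + (y + v)
  interchange = NatSolver.solve-∀

totalDeg-1ₘ : ∀ n → totalDeg (1ₘ {n}) ≡ 0
totalDeg-1ₘ zero    = refl
totalDeg-1ₘ (suc n) = totalDeg-1ₘ n

degrees-⊙ : ∀ {n} (S T : List (Monomial n)) d e → DegreesAtMost d S → DegreesAtMost e T → DegreesAtMost (d + e) (S ⊙ T)
degrees-⊙ S T d e S≤d T≤e x∈ with ∈-cartesianProductWith⁻ _·ₘ_ S T x∈
... | a , b , a∈S , b∈T , refl = subst (_≤ d + e) (sym (totalDeg-·ₘ a b)) (NP.+-mono-≤ (S≤d a∈S) (T≤e b∈T))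

degrees-^ₛ : ∀ {n} (S : List (Monomial n)) d → DegreesAtMost d S → ∀ e → DegreesAtMost (e * d) (S ^ₛ e)
degrees-^ₛ {n} S d S≤d zero    (here refl) = NP.≤-reflexive (totalDeg-1ₘ n)
degrees-^ₛ     S d S≤d (suc e) = degrees-⊙ S (S ^ₛ e) d (e * d) S≤d (degrees-^ₛ S d S≤d e)

degrees-monSupport : ∀ {m n} (a : Monomial m) (S : Fin m → List (Monomial n)) E →
  (∀ j → DegreesAtMost E (S j)) → DegreesAtMost (totalDeg a * E) (monSupport a S)
degrees-monSupport {n = n} []      S E S≤E (here refl) = NP.≤-reflexive (totalDeg-1ₘ n)
degrees-monSupport         (e ∷ a) S E S≤E =
  subst (λ d → DegreesAtMost d (monSupport (e ∷ a) S)) (sym (NP.*-distribʳ-+ E e (totalDeg a)))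
    (degrees-⊙ (S Fin.zero ^ₛ e) (monSupport a (λ i → S (Fin.suc i))) (e * E) (totalDeg a * E)
      (degrees-^ₛ (S Fin.zero) E (S≤E Fin.zero) e)
      (degrees-monSupport a (λ i → S (Fin.suc i)) E (λ i → S≤E (Fin.suc i))))

≤-max : ∀ {x} (xs : List ℕ) → x ∈ xs → x ≤ foldr _⊔_ 0 xs
≤-max (y ∷ xs) (here refl) = NP.m≤m⊔n y _
≤-max (y ∷ xs) (there x∈)  = NP.≤-trans (≤-max xs x∈) (NP.m≤n⊔m y _)

max-≤ : ∀ (xs : List ℕ) c → (∀ {x} → x ∈ xs → x ≤ c) → foldr _⊔_ 0 xs ≤ c
max-≤ []       c xs≤c = z≤n
max-≤ (y ∷ xs) c xs≤c = NP.⊔-lub (xs≤c (here refl)) (max-≤ xs c (λ x∈ → xs≤c (there x∈)))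

len-≤-lenMap : ∀ {n} (T : PolyMap n) j → len (T j) ≤ lenMap T
len-≤-lenMap {n} T j = ≤-max _ (∈-map⁺ (λ i → len (T i)) (∈-allFin j))

lenMap-≤ : ∀ {n} (T : PolyMap n) c → (∀ j → len (T j) ≤ c) → lenMap T ≤ c
lenMap-≤ {n} T c T≤c = max-≤ _ c λ x∈ → bound (∈-map⁻ (λ i → len (T i)) x∈)
  where
  bound : ∀ {x} → ∃[ j ] (j ∈ allFin n × x ≡ len (T j)) → x ≤ c
  bound (j , _ , refl) = T≤c j

deg-≤-maxDeg : ∀ {n} (H : PolyMap n) j → deg (H j) ≤ maxDeg H
deg-≤-maxDeg {n} H j = ≤-max _ (∈-map⁺ (λ i → deg (H i)) (∈-allFin j))

totalDeg-≤-deg : ∀ {n} (p : Poly n) {b} → b ∈ support p → totalDeg b ≤ deg p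
totalDeg-≤-deg p b∈ = ≤-max (map totalDeg (support p)) (∈-map⁺ totalDeg b∈)

stepSupport : ∀ {n} → Poly n → (Fin n → List (Monomial n)) → List (Monomial n)
stepSupport P S = compSupport P S ++ support P

supported-step : ∀ {n} (P : Poly n) (G : PolyMap n) → SupportedIn (compose P G -ₚ P) (stepSupport P (λ j → support (G j)))
supported-step P G =
  supported-++ (compose P G) (negP P) _ (support P)
    (supported-compose P G _ (λ j → supported-support (G j)))
    (supported-neg P (support P) (supported-support P))

length-step : ∀ {n} (P : Poly n) (G : PolyMap n) L B → (∀ j → len (G j) ≤ L) →
  (∀ {a} → a ∈ support P → L ^ totalDeg a ≤ B) → len (compose P G -ₚ P) ≤ len P * (B + 1)
length-step P G L B G≤L P≤B = begin
  len (compose P G -ₚ P)                              ≤⟨ len-≤ (compose P G -ₚ P) _ (supported-step P G) ⟩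
  length (compSupport P SG ++ support P)              ≡⟨ LP.length-++ (compSupport P SG) ⟩
  length (compSupport P SG) + len P                   ≤⟨ NP.+-monoˡ-≤ (len P) composed-part ⟩
  len P * B + len P                                   ≡⟨ cong (len P * B +_) (sym (NP.*-identityʳ (len P))) ⟩
  len P * B + len P * 1                               ≡⟨ sym (NP.*-distribˡ-+ (len P) B 1) ⟩
  len P * (B + 1)                                     ∎
  where
  open NP.≤-Reasoning
  SG : Fin _ → List (Monomial _)
  SG j = support (G j)
  composed-part : length (compSupport P SG) ≤ len P * B
  composed-part = length-concatMap (λ a → monSupport a SG) (support P) B
    (λ {a} a∈ → NP.≤-trans (length-monSupport a SG L G≤L) (P≤B a∈))

degrees-step : ∀ {n} (P : Poly n) (S : Fin n → List (Monomial n)) E d → 1 ≤ E →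
  (∀ j → DegreesAtMost E (S j)) → DegreesAtMost d (support P) → DegreesAtMost (E * d) (stepSupport P S)
degrees-step P S E d 1≤E S≤E P≤d x∈ with ∈-++⁻ (compSupport P S) x∈
... | inj₂ x∈P = NP.≤-trans (P≤d x∈P) (NP.m≤n*m d E {{ℕ.>-nonZero 1≤E}})
... | inj₁ x∈PS with find (∈-concatMap⁻ (λ a → monSupport a S) x∈PS)
...   | a , a∈P , x∈a =
  NP.≤-trans (degrees-monSupport a S E S≤E x∈a)
             (NP.≤-trans (NP.*-monoˡ-≤ E (P≤d a∈P)) (NP.≤-reflexive (NP.*-comm d E)))

xₘ : ∀ {n} → Fin n → Monomial n
xₘ j = 1ₘ Vec.[ j ]≔ 1

totalDeg-xₘ : ∀ {n} (j : Fin n) → totalDeg (xₘ j) ≡ 1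
totalDeg-xₘ {suc n} Fin.zero    = cong suc (totalDeg-1ₘ n)
totalDeg-xₘ {suc n} (Fin.suc j) = totalDeg-xₘ j

coeff-var : ∀ {n} (j : Fin n) → coeff (var j) (xₘ j) ≡ 1ℤ
coeff-var j with xₘ j ≟ₘ xₘ j
... | yes _  = refl
... | no  ne = ⊥-elim (ne refl)

exponent-bound : ∀ L D k x → 1 ≤ k → (D ≡ 0 → L ≤ 1) → (1 ≤ D → 1 ≤ L × x ≤ D ^ k) → L ^ x ≤ L ^ (D ^ k)
exponent-bound L zero    (suc k) x _ L≤1 _ =
  NP.≤-trans (NP.^-monoˡ-≤ x (L≤1 refl)) (NP.≤-reflexive (NP.^-zeroˡ x))
exponent-bound L (suc d) (suc k) x _ _ D≥1⇒ with D≥1⇒ (s≤s z≤n)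
... | 1≤L , x≤Dᵏ = NP.^-monoʳ-≤ L {{ℕ.>-nonZero 1≤L}} x≤Dᵏ

-- If max deg Hᵢ ≥ 1 there is at least one coordinate (the max over no coordinates is 0).
someCoordinate : ∀ {n} (H : PolyMap n) → 1 ≤ maxDeg H → Fin n
someCoordinate {suc n} H _ = Fin.zero

module XPlusH {n : ℕ} (H : PolyMap n) (low : ∀ i → LowerDegAtLeast 2 (H i)) where
  F : PolyMap n
  F = addId H

  D : ℕ
  D = maxDeg H

  monomial-of-F : ∀ j b → coeff (F j) b ≢ 0ℤ → b ≡ xₘ j ⊎ coeff (H j) b ≢ 0ℤ
  monomial-of-F j b ne
    with ∈-++⁻ (xₘ j ∷ []) (supported-++ (var j) (H j) _ _ (supported-written (var j)) (supported-support (H j)) b ne)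
  ... | inj₁ (here b≡xⱼ) = inj₁ b≡xⱼ
  ... | inj₂ b∈H         = inj₂ (support-nonzero (H j) b∈H)

  -- If D = 0 then H = 0 (its monomials would have degree ≥ 2 and ≤ 0), so l(F) ≤ 1.
  lenF≤1 : D ≡ 0 → lenMap F ≤ 1
  lenF≤1 D≡0 = lenMap-≤ F 1 λ j → len-≤ (F j) (xₘ j ∷ []) (only-xⱼ j)
    where
    only-xⱼ : ∀ j b → coeff (F j) b ≢ 0ℤ → b ∈ xₘ j ∷ []
    only-xⱼ j b ne with monomial-of-F j b ne
    ... | inj₁ b≡xⱼ = here b≡xⱼ
    ... | inj₂ cH≢0 = ⊥-elim (NP.<⇒≱ (s≤s z≤n) (begin
      2           ≤⟨ low j b cH≢0 ⟩
      totalDeg b  ≤⟨ totalDeg-≤-deg (H j) (supported-support (H j) b cH≢0) ⟩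
      deg (H j)   ≤⟨ deg-≤-maxDeg H j ⟩
      D           ≡⟨ D≡0 ⟩
      0           ∎))
      where open NP.≤-Reasoning

  -- X_j survives in F_j = X_j + H_j, because H_j has no monomial of degree 1.
  lenF≥1 : Fin n → 1 ≤ lenMap F
  lenF≥1 j = NP.≤-trans (nonempty (supported-support (F j) (xₘ j) xⱼ∈Fⱼ)) (len-≤-lenMap F j)
    where
    nonempty : ∀ {x} {xs : List (Monomial n)} → x ∈ xs → 1 ≤ length xs
    nonempty (here _)  = s≤s z≤n
    nonempty (there _) = s≤s z≤n

    xⱼ∉Hⱼ : coeff (H j) (xₘ j) ≡ 0ℤ
    xⱼ∉Hⱼ with coeff (H j) (xₘ j) ℤ.≟ 0ℤ
    ... | yes c≡0 = c≡0
    ... | no  c≢0 = ⊥-elim (NP.<⇒≱ (s≤s (s≤s z≤n)) (subst (2 ≤_) (totalDeg-xₘ j) (low j (xₘ j) c≢0)))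

    xⱼ∈Fⱼ : coeff (F j) (xₘ j) ≢ 0ℤ
    xⱼ∈Fⱼ c≡0 with () ← trans (sym (trans (coeff-++ (var j) (H j) (xₘ j)) (cong₂ ℤ._+_ (coeff-var j) xⱼ∉Hⱼ))) c≡0

  degrees-F : 1 ≤ D → ∀ j → DegreesAtMost D (support (F j))
  degrees-F 1≤D j {b} b∈ with monomial-of-F j b (support-nonzero (F j) b∈)
  ... | inj₁ refl = subst (_≤ D) (sym (totalDeg-xₘ j)) 1≤D
  ... | inj₂ cH≢0 = NP.≤-trans (totalDeg-≤-deg (H j) (supported-support (H j) b cH≢0)) (deg-≤-maxDeg H j)

  degrees-P : 1 ≤ D → ∀ k i → DegreesAtMost (D ^ k) (support (Pseq F k i))
  degrees-P 1≤D zero    i b∈ with supported-written (var i) _ (support-nonzero (var i) b∈)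
  ... | here refl = NP.≤-reflexive (totalDeg-xₘ i)
  degrees-P 1≤D (suc k) i b∈ =
    degrees-step P (λ j → support (F j)) D (D ^ k) 1≤D (degrees-F 1≤D) (degrees-P 1≤D k i)
      (supported-step P F _ (support-nonzero (Pseq F (suc k) i) b∈))
    where
    P : Poly n
    P = Pseq F k i

  length-P : ∀ k → 1 ≤ k → lenMap (Pseq F (suc k)) ≤ lenMap (Pseq F k) * (lenMap F ^ (D ^ k) + 1)
  length-P k 1≤k = lenMap-≤ (Pseq F (suc k)) _ λ i →
    NP.≤-trans (length-step (Pseq F k i) F (lenMap F) (lenMap F ^ (D ^ k)) (len-≤-lenMap F) (exponents-bounded i))
               (NP.*-monoˡ-≤ _ (len-≤-lenMap (Pseq F k) i))
    where
    exponents-bounded : ∀ i {a} → a ∈ support (Pseq F k i) → lenMap F ^ totalDeg a ≤ lenMap F ^ (D ^ k)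
    exponents-bounded i {a} a∈ = exponent-bound (lenMap F) D k (totalDeg a) 1≤k lenF≤1
      (λ 1≤D → lenF≥1 (someCoordinate H 1≤D) , degrees-P 1≤D k i a∈)

lemma4p1 : (n : ℕ) (H : PolyMap n) → (∀ i → LowerDegAtLeast 2 (H i)) →
           (k : ℕ) → 1 ≤ k →
           lenMap (Pseq (addId H) (k + 1))
             ≤ lenMap (Pseq (addId H) k) * (lenMap (addId H) ^ (maxDeg H ^ k) + 1)
lemma4p1 n H low k 1≤k rewrite NP.+-comm k 1 = XPlusH.length-P H low k 1≤k
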